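{- If $C_1$ and $C_2$ are circuits of an antisymmetric matroid on $E$, then $|C_1\cap C_2^*|\ne1$.
   Context: Let $E=[n]\cup[n]^*$ with involution $i\leftrightarrow i^*$, extended to sets by $X^*=\{x^*:x\in X\}$ (with $(i^*)^*=i$); a skew pair is $\{i,i^*\}$; $\mathcal{T}_n$ (transversals) are $n$-subsets of $E$ with no skew pair, $\mathcal{A}_n$ (almost-transversals) $n$-subsets with exactly one skew pair. An antisymmetric matroid on $E$ is $(E,\mathcal{B})$ with $\mathcal{B}\subseteq\mathcal{T}_n\cup\mathcal{A}_n$ satisfying (B1) $\mathcal{B}\ne\emptyset$; (B2) for $T\in\mathcal{T}_n$ and distinct skew pairs $p,q$, $(T\cup p)\setminus q\in\mathcal{B}$ iff $(T\cup q)\setminus p\in\mathcal{B}$; (Exch) for $B,B'\in\mathcal{B}$ and $e\in B\setminus B'$ with $B\setminus\{e\}$ having no skew pair and $B'\cup\{e\}$ having exactly one skew pair, there is $f\in B'\setminus B$ with both $(B\setminus\{e\})\cup\{f\}$ and $(B'\cup\{e\})\setminus\{f\}$ in $\mathcal{B}$. Elements of $\mathcal{B}$ are bases. A circuit is an inclusion-minimal subset of $E$ containing at most one skew pair and contained in no basis. -}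

module Defs where

open import Data.Nat using (ℕ; _≤_; _+_)
open import Data.Fin using (Fin)
open import Data.Fin.Subset as S using (Subset; ⁅_⁆)
open import Data.Sum using (_⊎_; inj₁; inj₂)
open import Data.Product using (_×_; _,_; proj₁; proj₂; Σ; ∃; ∃-syntax)
open import Relation.Binary.PropositionalEquality using (_≡_; _≢_)
open import Relation.Nullary using (¬_)
open import Function.Bundles using (_⇔_)

-- The ground set E = [n] ∪ [n]* : inj₁ i is i, inj₂ i is i*.
El : ℕ → Set
El n = Fin n ⊎ Fin n

star : ∀ {n} → El n → El n
star (inj₁ i) = inj₂ i
star (inj₂ i) = inj₁ i

-- A subset X of E, given by its unstarred part and its starred part:
-- proj₁ X = {i : i ∈ X}, proj₂ X = {i : i* ∈ X}.
-- (Propositional equality of such pairs is equality of subsets.)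
ESub : ℕ → Set
ESub n = Subset n × Subset n

module _ {n : ℕ} where

  infix 4 _∈E_ _∉E_ _⊆E_
  infixr 7 _∩E_
  infixr 6 _∪E_

  _∈E_ : El n → ESub n → Set
  inj₁ i ∈E X = i S.∈ proj₁ X
  inj₂ i ∈E X = i S.∈ proj₂ X

  _∉E_ : El n → ESub n → Set
  e ∉E X = ¬ (e ∈E X)

  _⊆E_ : ESub n → ESub n → Set
  X ⊆E Y = ∀ e → e ∈E X → e ∈E Y

  _∩E_ : ESub n → ESub n → ESub n
  (A , B) ∩E (A' , B') = (A S.∩ A' , B S.∩ B')

  _∪E_ : ESub n → ESub n → ESub n
  (A , B) ∪E (A' , B') = (A S.∪ A' , B S.∪ B')

  _∖E_ : ESub n → ESub n → ESub n
  (A , B) ∖E (A' , B') = (A S.─ A' , B S.─ B')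

  _* : ESub n → ESub n
  (A , B) * = (B , A)

  ⟦_⟧ : El n → ESub n
  ⟦ inj₁ i ⟧ = (⁅ i ⁆ , S.⊥)
  ⟦ inj₂ i ⟧ = (S.⊥ , ⁅ i ⁆)

  skew : Fin n → ESub n
  skew i = (⁅ i ⁆ , ⁅ i ⁆)

  ∣_∣E : ESub n → ℕ
  ∣ (A , B) ∣E = S.∣ A ∣ + S.∣ B ∣

  #skew : ESub n → ℕ
  #skew (A , B) = S.∣ A S.∩ B ∣

  Transversal : ESub n → Set
  Transversal X = (∣ X ∣E ≡ n) × (#skew X ≡ 0)

  AlmostTransversal : ESub n → Set
  AlmostTransversal X = (∣ X ∣E ≡ n) × (#skew X ≡ 1)

record IsAntisymmetricMatroid (n : ℕ) (𝓑 : ESub n → Set) : Set where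
  field
    bases-shape : ∀ B → 𝓑 B → Transversal B ⊎ AlmostTransversal B
    B1 : ∃[ B ] 𝓑 B
    B2 : ∀ (T : ESub n) → Transversal T → ∀ (p q : Fin n) → p ≢ q →
         𝓑 ((T ∪E skew p) ∖E skew q) ⇔ 𝓑 ((T ∪E skew q) ∖E skew p)
    Exch : ∀ B B' → 𝓑 B → 𝓑 B' → ∀ (e : El n) → e ∈E B → e ∉E B' →
           #skew (B ∖E ⟦ e ⟧) ≡ 0 → #skew (B' ∪E ⟦ e ⟧) ≡ 1 →
           ∃[ f ] (f ∈E B' × f ∉E B ×
                   𝓑 ((B ∖E ⟦ e ⟧) ∪E ⟦ f ⟧) × 𝓑 ((B' ∪E ⟦ e ⟧) ∖E ⟦ f ⟧))

Independent : ∀ {n} → (ESub n → Set) → ESub n → Set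
Independent 𝓑 X = ∃[ B ] (𝓑 B × X ⊆E B)

IsCircuit : ∀ {n} → (ESub n → Set) → ESub n → Set
IsCircuit 𝓑 C =
  (#skew C ≤ 1) × ¬ Independent 𝓑 C ×
  (∀ D → D ⊆E C → D ≢ C → #skew D ≤ 1 → Independent 𝓑 D)

{-# OPTIONS --safe #-}
-- For a circuit C and e ∈ C there is a basis B with C ⊆ B ∪ {e} such that B ∪ {e} contains
-- exactly one skew pair, and by (B2) the map X ↦ (E ∖ X)* sends bases to bases. Suppose e is
-- the only element of C₁ with e* ∈ C₂. Take such bases B₁ for (C₁, e) and B₂ for (C₂, e*) and
-- exchange e from (E ∖ B₂)* into B₁. The element f received lies in C₁ (otherwise C₁ would lie
-- in a basis) and differs from e, so f* ∉ C₂; hence the resulting basis B₃ satisfies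
-- C₂ ⊆ (E ∖ B₃)*, contradicting the dependence of C₂.
module Submission where

open import Defs
open import Data.Nat using (ℕ; suc; _+_; _≤_; _<_; z≤n)
open import Data.Nat.Properties
  using (suc-injective; +-suc; +-cancelˡ-≡; ≤-reflexive; ≤-trans; <-≤-trans; n≮0; n<1⇒n≡0; n≤0⇒n≡0; m+[n∸m]≡n)
open import Data.Fin using (Fin; zero; suc; _≟_)
open import Data.Fin.Subset
  using (Subset; inside; outside; _∈_; _∉_; _⊆_; _∩_; _∪_; _─_; _-_; ∁; ⁅_⁆; ∣_∣; Empty)
  renaming (⊥ to ∅)
open import Data.Fin.Subset.Properties
open import Data.Vec using ([]; _∷_; here; there)
open import Data.Product using (_×_; _,_; ∃-syntax; proj₁; proj₂; uncurry)
open import Data.Sum using (_⊎_; inj₁; inj₂; [_,_]′)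
open import Data.Sum.Properties using (≡-dec)
open import Data.Empty using (⊥; ⊥-elim)
open import Function using (_∘_; id; case_of_)
open import Function.Bundles using (Equivalence)
open import Relation.Nullary using (Dec; yes; no)
open import Relation.Nullary.Decidable using (decidable-stable)
open import Relation.Nullary.Negation using (contradiction)
open import Relation.Binary using (DecidableEquality)
open import Relation.Binary.PropositionalEquality

private variable
  n : ℕ
  p q : Subset n
  x y : Fin n
  X Y : ESub n
  d e : El n

-- Subsets of Fin n

x∈p─q⇒x∉q : x ∈ p ─ q → x ∉ q
x∈p─q⇒x∉q {p = _ ∷ _} {q = outside ∷ _} (there x∈p─q) (there x∈q) = x∈p─q⇒x∉q x∈p─q x∈q
x∈p─q⇒x∉q {p = _ ∷ _} {q = inside ∷ _} (there x∈p─q) (there x∈q) = x∈p─q⇒x∉q x∈p─q x∈q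

∣p∣≡0⇒x∉p : ∣ p ∣ ≡ 0 → x ∉ p
∣p∣≡0⇒x∉p {p = p} {x} ∣p∣≡0 x∈p = n≮0 (subst (∣ p - x ∣ <_) ∣p∣≡0 (x∈p⇒∣p-x∣<∣p∣ x∈p))

Empty⇒∣p∣≡0 : Empty p → ∣ p ∣ ≡ 0
Empty⇒∣p∣≡0 {n} empty = trans (cong ∣_∣ (Empty-unique empty)) (∣⊥∣≡0 n)

∣p∣≤1⇒x≡y : ∣ p ∣ ≤ 1 → x ∈ p → y ∈ p → x ≡ y
∣p∣≤1⇒x≡y {x = x} {y} ∣p∣≤1 x∈p y∈p with x ≟ y
... | yes x≡y = x≡y
... | no x≢y = contradiction (x∈p∧x≢y⇒x∈p-y y∈p (x≢y ∘ sym))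
                             (∣p∣≡0⇒x∉p (n<1⇒n≡0 (<-≤-trans (x∈p⇒∣p-x∣<∣p∣ x∈p) ∣p∣≤1)))

∣p∣≡1⇒∃! : ∣ p ∣ ≡ 1 → ∃[ x ] (x ∈ p × ∀ {y} → y ∈ p → y ≡ x)
∣p∣≡1⇒∃! {p = p} ∣p∣≡1 with nonempty? p
... | yes (x , x∈p) = x , x∈p , λ y∈p → ∣p∣≤1⇒x≡y (≤-reflexive ∣p∣≡1) y∈p x∈p
... | no empty = contradiction (trans (sym ∣p∣≡1) (Empty⇒∣p∣≡0 empty)) λ ()

x∉p⇒⁅x⁆∩p≡∅ : x ∉ p → ⁅ x ⁆ ∩ p ≡ ∅
x∉p⇒⁅x⁆∩p≡∅ {x = x} {p = p} x∉p = Empty-unique λ (y , y∈⁅x⁆∩p) →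
  let y∈⁅x⁆ , y∈p = x∈p∩q⁻ ⁅ x ⁆ p y∈⁅x⁆∩p in x∉p (subst (_∈ p) (x∈⁅y⁆⇒x≡y x y∈⁅x⁆) y∈p)

x∉q⇒[p∪⁅x⁆]∩q≡p∩q : x ∉ q → (p ∪ ⁅ x ⁆) ∩ q ≡ p ∩ q
x∉q⇒[p∪⁅x⁆]∩q≡p∩q {x = x} {q = q} {p = p} x∉q = begin
  (p ∪ ⁅ x ⁆) ∩ q       ≡⟨ ∩-distribʳ-∪ q p ⁅ x ⁆ ⟩
  p ∩ q ∪ ⁅ x ⁆ ∩ q     ≡⟨ cong (p ∩ q ∪_) (x∉p⇒⁅x⁆∩p≡∅ x∉q) ⟩
  p ∩ q ∪ ∅             ≡⟨ ∪-identityʳ (p ∩ q) ⟩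
  p ∩ q                 ∎
  where open ≡-Reasoning

x∉p⇒∣p∪⁅x⁆∣≡1+∣p∣ : x ∉ p → ∣ p ∪ ⁅ x ⁆ ∣ ≡ suc ∣ p ∣
x∉p⇒∣p∪⁅x⁆∣≡1+∣p∣ {x = zero} {p = outside ∷ p}  _   = cong (suc ∘ ∣_∣) (∪-identityʳ p)
x∉p⇒∣p∪⁅x⁆∣≡1+∣p∣ {x = zero} {p = inside ∷ p}  x∉p = contradiction here x∉p
x∉p⇒∣p∪⁅x⁆∣≡1+∣p∣ {x = suc x} {p = outside ∷ p} x∉p = x∉p⇒∣p∪⁅x⁆∣≡1+∣p∣ (x∉p ∘ there)
x∉p⇒∣p∪⁅x⁆∣≡1+∣p∣ {x = suc x} {p = inside ∷ p} x∉p = cong suc (x∉p⇒∣p∪⁅x⁆∣≡1+∣p∣ (x∉p ∘ there))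

x∈p∧y∉p⇒p∪⁅x⁆─⁅y⁆≡p : x ∈ p → y ∉ p → p ∪ ⁅ x ⁆ ─ ⁅ y ⁆ ≡ p
x∈p∧y∉p⇒p∪⁅x⁆─⁅y⁆≡p {x = x} {p = p} {y = y} x∈p y∉p = ⊆-antisym ⊆p ⊇p
  where
  ⊆p : p ∪ ⁅ x ⁆ ─ ⁅ y ⁆ ⊆ p
  ⊆p i∈ with x∈p∪q⁻ p ⁅ x ⁆ (p─q⊆p _ _ i∈)
  ... | inj₁ i∈p    = i∈p
  ... | inj₂ i∈⁅x⁆ = subst (_∈ p) (sym (x∈⁅y⁆⇒x≡y x i∈⁅x⁆)) x∈p
  ⊇p : p ⊆ p ∪ ⁅ x ⁆ ─ ⁅ y ⁆
  ⊇p i∈p = x∈p∧x∉q⇒x∈p─q (p⊆p∪q ⁅ x ⁆ i∈p) λ i∈⁅y⁆ → y∉p (subst (_∈ p) (x∈⁅y⁆⇒x≡y y i∈⁅y⁆) i∈p)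

∣p∣+∣q∣+∣∁p∩∁q∣≡n+∣p∩q∣ : ∀ (p q : Subset n) → ∣ p ∣ + ∣ q ∣ + ∣ ∁ p ∩ ∁ q ∣ ≡ n + ∣ p ∩ q ∣
∣p∣+∣q∣+∣∁p∩∁q∣≡n+∣p∩q∣ []            []            = refl
∣p∣+∣q∣+∣∁p∩∁q∣≡n+∣p∩q∣ {suc n} (inside  ∷ p) (inside  ∷ q) = cong suc (begin
  ∣ p ∣ + suc ∣ q ∣ + ∣ ∁ p ∩ ∁ q ∣ ≡⟨ cong (_+ ∣ ∁ p ∩ ∁ q ∣) (+-suc ∣ p ∣ ∣ q ∣) ⟩
  suc (∣ p ∣ + ∣ q ∣ + ∣ ∁ p ∩ ∁ q ∣) ≡⟨ cong suc (∣p∣+∣q∣+∣∁p∩∁q∣≡n+∣p∩q∣ p q) ⟩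
  suc (n + ∣ p ∩ q ∣) ≡⟨ +-suc n ∣ p ∩ q ∣ ⟨
  n + suc ∣ p ∩ q ∣ ∎)
  where open ≡-Reasoning
∣p∣+∣q∣+∣∁p∩∁q∣≡n+∣p∩q∣ (inside  ∷ p) (outside ∷ q) = cong suc (∣p∣+∣q∣+∣∁p∩∁q∣≡n+∣p∩q∣ p q)
∣p∣+∣q∣+∣∁p∩∁q∣≡n+∣p∩q∣ (outside ∷ p) (inside  ∷ q) =
  trans (cong (_+ ∣ ∁ p ∩ ∁ q ∣) (+-suc ∣ p ∣ ∣ q ∣)) (cong suc (∣p∣+∣q∣+∣∁p∩∁q∣≡n+∣p∩q∣ p q))
∣p∣+∣q∣+∣∁p∩∁q∣≡n+∣p∩q∣ (outside ∷ p) (outside ∷ q) =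
  trans (+-suc (∣ p ∣ + ∣ q ∣) ∣ ∁ p ∩ ∁ q ∣) (cong suc (∣p∣+∣q∣+∣∁p∩∁q∣≡n+∣p∩q∣ p q))

module _ {A B : Subset n} {p q : Fin n}
         (p∈A∩B : p ∈ A ∩ B) (pair-unique : ∀ {i} → i ∈ A ∩ B → i ≡ p)
         (q∈∁A∩∁B : q ∈ ∁ A ∩ ∁ B) (hole-unique : ∀ {i} → i ∈ ∁ A ∩ ∁ B → i ≡ q) where

  private
    p∈B : p ∈ B
    p∈B = proj₂ (x∈p∩q⁻ A B p∈A∩B)

    q∉B : q ∉ B
    q∉B = x∈∁p⇒x∉p (proj₂ (x∈p∩q⁻ (∁ A) (∁ B) q∈∁A∩∁B))

  B≡∁A∪⁅p⁆─⁅q⁆ : B ≡ ∁ A ∪ ⁅ p ⁆ ─ ⁅ q ⁆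
  B≡∁A∪⁅p⁆─⁅q⁆ = ⊆-antisym to from
    where
    to : B ⊆ ∁ A ∪ ⁅ p ⁆ ─ ⁅ q ⁆
    to {i} i∈B = x∈p∧x∉q⇒x∈p─q i∈∁A∪⁅p⁆ λ i∈⁅q⁆ → q∉B (subst (_∈ B) (x∈⁅y⁆⇒x≡y q i∈⁅q⁆) i∈B)
      where
      i∈∁A∪⁅p⁆ : i ∈ ∁ A ∪ ⁅ p ⁆
      i∈∁A∪⁅p⁆ with i ∈? A
      ... | yes i∈A = q⊆p∪q (∁ A) ⁅ p ⁆ (Equivalence.from x∈⁅y⁆⇔x≡y (pair-unique (x∈p∩q⁺ (i∈A , i∈B))))
      ... | no  i∉A = p⊆p∪q ⁅ p ⁆ (x∉p⇒x∈∁p i∉A)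
    from : ∁ A ∪ ⁅ p ⁆ ─ ⁅ q ⁆ ⊆ B
    from {i} i∈ with x∈p∪q⁻ (∁ A) ⁅ p ⁆ (p─q⊆p _ _ i∈) | i ∈? B
    ... | _          | yes i∈B = i∈B
    ... | inj₁ i∈∁A  | no  i∉B = contradiction
      (Equivalence.from x∈⁅y⁆⇔x≡y (hole-unique (x∈p∩q⁺ (i∈∁A , x∉p⇒x∈∁p i∉B)))) (x∈p─q⇒x∉q i∈)
    ... | inj₂ i∈⁅p⁆ | no  i∉B = contradiction (subst (_∈ B) (sym (x∈⁅y⁆⇒x≡y p i∈⁅p⁆)) p∈B) i∉B

  ∁B≡A∪⁅q⁆─⁅p⁆ : ∁ B ≡ A ∪ ⁅ q ⁆ ─ ⁅ p ⁆
  ∁B≡A∪⁅q⁆─⁅p⁆ = ⊆-antisym to from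
    where
    to : ∁ B ⊆ A ∪ ⁅ q ⁆ ─ ⁅ p ⁆
    to {i} i∈∁B = x∈p∧x∉q⇒x∈p─q i∈A∪⁅q⁆ λ i∈⁅p⁆ → x∈∁p⇒x∉p i∈∁B (subst (_∈ B) (sym (x∈⁅y⁆⇒x≡y p i∈⁅p⁆)) p∈B)
      where
      i∈A∪⁅q⁆ : i ∈ A ∪ ⁅ q ⁆
      i∈A∪⁅q⁆ with i ∈? A
      ... | yes i∈A = p⊆p∪q ⁅ q ⁆ i∈A
      ... | no  i∉A = q⊆p∪q A ⁅ q ⁆ (Equivalence.from x∈⁅y⁆⇔x≡y (hole-unique (x∈p∩q⁺ (x∉p⇒x∈∁p i∉A , i∈∁B))))
    from : A ∪ ⁅ q ⁆ ─ ⁅ p ⁆ ⊆ ∁ B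
    from {i} i∈ = x∉p⇒x∈∁p λ i∈B → case x∈p∪q⁻ A ⁅ q ⁆ (p─q⊆p _ _ i∈) of λ where
      (inj₁ i∈A)   → x∈p─q⇒x∉q i∈ (Equivalence.from x∈⁅y⁆⇔x≡y (pair-unique (x∈p∩q⁺ (i∈A , i∈B))))
      (inj₂ i∈⁅q⁆) → q∉B (subst (_∈ B) (x∈⁅y⁆⇒x≡y q i∈⁅q⁆) i∈B)

-- Subsets of E

_ᶜ : ESub n → ESub n
(A , B) ᶜ = (∁ A , ∁ B)

pairs : ESub n → Subset n
pairs (A , B) = A ∩ B

_≟E_ : DecidableEquality (El n)
_≟E_ = ≡-dec _≟_ _≟_

_∈E?_ : (e : El n) (X : ESub n) → Dec (e ∈E X)
inj₁ i ∈E? X = i ∈? proj₁ X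
inj₂ i ∈E? X = i ∈? proj₂ X

star-involutive : star (star e) ≡ e
star-involutive {e = inj₁ _} = refl
star-involutive {e = inj₂ _} = refl

star-injective : star d ≡ star e → d ≡ e
star-injective eq = trans (sym star-involutive) (trans (cong star eq) star-involutive)

⊆E-antisym : X ⊆E Y → Y ⊆E X → X ≡ Y
⊆E-antisym X⊆Y Y⊆X = cong₂ _,_ (⊆-antisym (X⊆Y (inj₁ _)) (Y⊆X (inj₁ _)))
                                (⊆-antisym (X⊆Y (inj₂ _)) (Y⊆X (inj₂ _)))

∪E⁺ˡ : e ∈E X → e ∈E X ∪E Y
∪E⁺ˡ {e = inj₁ _} {Y = Y} = p⊆p∪q (proj₁ Y)
∪E⁺ˡ {e = inj₂ _} {Y = Y} = p⊆p∪q (proj₂ Y)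

∪E⁺ʳ : e ∈E Y → e ∈E X ∪E Y
∪E⁺ʳ {e = inj₁ _} {X = X} = q⊆p∪q (proj₁ X) _
∪E⁺ʳ {e = inj₂ _} {X = X} = q⊆p∪q (proj₂ X) _

∪E⁻ : e ∈E X ∪E Y → e ∈E X ⊎ e ∈E Y
∪E⁻ {e = inj₁ _} {X = X} {Y} = x∈p∪q⁻ (proj₁ X) (proj₁ Y)
∪E⁻ {e = inj₂ _} {X = X} {Y} = x∈p∪q⁻ (proj₂ X) (proj₂ Y)

∖E⁺ : e ∈E X → e ∉E Y → e ∈E X ∖E Y
∖E⁺ {e = inj₁ _} = x∈p∧x∉q⇒x∈p─q
∖E⁺ {e = inj₂ _} = x∈p∧x∉q⇒x∈p─q

∖E⁻ : e ∈E X ∖E Y → e ∈E X × e ∉E Y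
∖E⁻ {e = inj₁ _} e∈ = p─q⊆p _ _ e∈ , x∈p─q⇒x∉q e∈
∖E⁻ {e = inj₂ _} e∈ = p─q⊆p _ _ e∈ , x∈p─q⇒x∉q e∈

∩E⁺ : e ∈E X × e ∈E Y → e ∈E X ∩E Y
∩E⁺ {e = inj₁ _} = x∈p∩q⁺
∩E⁺ {e = inj₂ _} = x∈p∩q⁺

∩E⁻ : e ∈E X ∩E Y → e ∈E X × e ∈E Y
∩E⁻ {e = inj₁ _} = x∈p∩q⁻ _ _
∩E⁻ {e = inj₂ _} = x∈p∩q⁻ _ _

ᶜ⁺ : e ∉E X → e ∈E X ᶜ
ᶜ⁺ {e = inj₁ _} = x∉p⇒x∈∁p
ᶜ⁺ {e = inj₂ _} = x∉p⇒x∈∁p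

ᶜ⁻ : e ∈E X ᶜ → e ∉E X
ᶜ⁻ {e = inj₁ _} = x∈∁p⇒x∉p
ᶜ⁻ {e = inj₂ _} = x∈∁p⇒x∉p

*⁺ : star e ∈E X → e ∈E X *
*⁺ {e = inj₁ _} = id
*⁺ {e = inj₂ _} = id

*⁻ : e ∈E X * → star e ∈E X
*⁻ {e = inj₁ _} = id
*⁻ {e = inj₂ _} = id

∈ᶜ*⁺ : star e ∉E X → e ∈E X ᶜ *
∈ᶜ*⁺ = *⁺ ∘ ᶜ⁺

∈ᶜ*⁻ : e ∈E X ᶜ * → star e ∉E X
∈ᶜ*⁻ {e = e} {X = X} = ᶜ⁻ {e = star e} {X = X} ∘ *⁻ {e = e} {X = X ᶜ}

e∈⟦e⟧ : e ∈E ⟦ e ⟧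
e∈⟦e⟧ {e = inj₁ i} = x∈⁅x⁆ i
e∈⟦e⟧ {e = inj₂ i} = x∈⁅x⁆ i

d≡e⇒d∈⟦e⟧ : d ≡ e → d ∈E ⟦ e ⟧
d≡e⇒d∈⟦e⟧ refl = e∈⟦e⟧

d∈⟦e⟧⇒d≡e : d ∈E ⟦ e ⟧ → d ≡ e
d∈⟦e⟧⇒d≡e {d = inj₁ _} {inj₁ j} d∈ = cong inj₁ (x∈⁅y⁆⇒x≡y j d∈)
d∈⟦e⟧⇒d≡e {d = inj₁ _} {inj₂ _} d∈ = contradiction d∈ ∉⊥
d∈⟦e⟧⇒d≡e {d = inj₂ _} {inj₁ _} d∈ = contradiction d∈ ∉⊥
d∈⟦e⟧⇒d≡e {d = inj₂ _} {inj₂ j} d∈ = cong inj₂ (x∈⁅y⁆⇒x≡y j d∈)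

pairs⁻ : ∀ {i} (X : ESub n) → i ∈ pairs X → inj₁ i ∈E X × inj₂ i ∈E X
pairs⁻ (A , B) = x∈p∩q⁻ A B

ᶜ-antitone : X ⊆E Y → Y ᶜ ⊆E X ᶜ
ᶜ-antitone X⊆Y e e∈Yᶜ = ᶜ⁺ (ᶜ⁻ e∈Yᶜ ∘ X⊆Y e)

∖⟦⟧⊆⇒⊆∪⟦⟧ : X ∖E ⟦ e ⟧ ⊆E Y → X ⊆E Y ∪E ⟦ e ⟧
∖⟦⟧⊆⇒⊆∪⟦⟧ {e = e} X∖e⊆Y d d∈X with d ≟E e
... | yes refl = ∪E⁺ʳ e∈⟦e⟧
... | no  d≢e  = ∪E⁺ˡ (X∖e⊆Y d (∖E⁺ d∈X (d≢e ∘ d∈⟦e⟧⇒d≡e)))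

⊆∪⟦⟧⇒⊆ : X ⊆E Y ∪E ⟦ e ⟧ → e ∈E Y → X ⊆E Y
⊆∪⟦⟧⇒⊆ X⊆Y∪e e∈Y d d∈X with ∪E⁻ (X⊆Y∪e d d∈X)
... | inj₁ d∈Y   = d∈Y
... | inj₂ d∈⟦e⟧ = subst (_∈E _) (sym (d∈⟦e⟧⇒d≡e d∈⟦e⟧)) e∈Y

⊆∖⟦⟧ : X ⊆E Y → e ∉E X → X ⊆E Y ∖E ⟦ e ⟧
⊆∖⟦⟧ X⊆Y e∉X d d∈X = ∖E⁺ (X⊆Y d d∈X) λ d∈⟦e⟧ → e∉X (subst (_∈E _) (d∈⟦e⟧⇒d≡e d∈⟦e⟧) d∈X)

∖⟦e⟧∪⟦e⟧≡ : e ∈E X → (X ∖E ⟦ e ⟧) ∪E ⟦ e ⟧ ≡ X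
∖⟦e⟧∪⟦e⟧≡ {e = e} {X = X} e∈X = ⊆E-antisym (⊆∪⟦⟧⇒⊆ ⊆X∪e e∈X) (∖⟦⟧⊆⇒⊆∪⟦⟧ {e = e} λ _ → id)
  where
  ⊆X∪e : (X ∖E ⟦ e ⟧) ∪E ⟦ e ⟧ ⊆E X ∪E ⟦ e ⟧
  ⊆X∪e d d∈ = [ ∪E⁺ˡ ∘ proj₁ ∘ ∖E⁻ , ∪E⁺ʳ ]′ (∪E⁻ d∈)

ᶜ*∖⟦e⟧≡[X∪⟦e*⟧]ᶜ* : (X ᶜ *) ∖E ⟦ e ⟧ ≡ (X ∪E ⟦ star e ⟧) ᶜ *
ᶜ*∖⟦e⟧≡[X∪⟦e*⟧]ᶜ* {X = X} {e = e} = ⊆E-antisym to from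
  where
  to : (X ᶜ *) ∖E ⟦ e ⟧ ⊆E (X ∪E ⟦ star e ⟧) ᶜ *
  to d d∈ with ∖E⁻ {e = d} d∈
  ... | d∈Xᶜ* , d∉⟦e⟧ = ∈ᶜ*⁺ {e = d} λ d*∈ → case ∪E⁻ {e = star d} d*∈ of λ where
    (inj₁ d*∈X)    → ∈ᶜ*⁻ {e = d} d∈Xᶜ* d*∈X
    (inj₂ d*∈⟦e*⟧) → d∉⟦e⟧ (d≡e⇒d∈⟦e⟧ (star-injective (d∈⟦e⟧⇒d≡e d*∈⟦e*⟧)))
  from : (X ∪E ⟦ star e ⟧) ᶜ * ⊆E (X ᶜ *) ∖E ⟦ e ⟧
  from d d∈ = ∖E⁺ (∈ᶜ*⁺ (∈ᶜ*⁻ d∈ ∘ ∪E⁺ˡ)) λ d∈⟦e⟧ →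
    ∈ᶜ*⁻ d∈ (∪E⁺ʳ (d≡e⇒d∈⟦e⟧ (cong star (d∈⟦e⟧⇒d≡e {d = d} {e = e} d∈⟦e⟧))))

#skew≡0⇒star∉ : #skew X ≡ 0 → e ∈E X → star e ∉E X
#skew≡0⇒star∉ {e = inj₁ _} #skew≡0 i∈A i∈B = ∣p∣≡0⇒x∉p #skew≡0 (x∈p∩q⁺ (i∈A , i∈B))
#skew≡0⇒star∉ {e = inj₂ _} #skew≡0 i∈B i∈A = ∣p∣≡0⇒x∉p #skew≡0 (x∈p∩q⁺ (i∈A , i∈B))

#skew≡0⇒pair-element∉ : #skew Y ≡ 0 → e ∈E X → star e ∈E X → ∃[ b ] (b ∈E X × star b ∈E X × b ∉E Y)
#skew≡0⇒pair-element∉ {Y = Y} {e = e} {X = X} #skewY≡0 e∈X e*∈X with e ∈E? Y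
... | yes e∈Y = star e , e*∈X , subst (_∈E X) (sym star-involutive) e∈X , #skew≡0⇒star∉ #skewY≡0 e∈Y
... | no  e∉Y = e , e∈X , e*∈X , e∉Y

#skew-mono : X ⊆E Y → #skew X ≤ #skew Y
#skew-mono X⊆Y = p⊆q⇒∣p∣≤∣q∣ λ i∈ →
  let i∈A , i∈B = x∈p∩q⁻ _ _ i∈ in x∈p∩q⁺ (X⊆Y (inj₁ _) i∈A , X⊆Y (inj₂ _) i∈B)

#skew-* : ∀ (X : ESub n) → #skew (X *) ≡ #skew X
#skew-* (A , B) = cong ∣_∣ (∩-comm B A)

star∉⇒#skew-∪⟦⟧ : ∀ (X : ESub n) → star e ∉E X → #skew (X ∪E ⟦ e ⟧) ≡ #skew X
star∉⇒#skew-∪⟦⟧ {e = inj₁ j} (A , B) j∉B = cong ∣_∣ (begin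
  (A ∪ ⁅ j ⁆) ∩ (B ∪ ∅)  ≡⟨ cong ((A ∪ ⁅ j ⁆) ∩_) (∪-identityʳ B) ⟩
  (A ∪ ⁅ j ⁆) ∩ B        ≡⟨ x∉q⇒[p∪⁅x⁆]∩q≡p∩q j∉B ⟩
  A ∩ B                  ∎)
  where open ≡-Reasoning
star∉⇒#skew-∪⟦⟧ {e = inj₂ j} (A , B) j∉A = cong ∣_∣ (begin
  (A ∪ ∅) ∩ (B ∪ ⁅ j ⁆)  ≡⟨ cong (_∩ (B ∪ ⁅ j ⁆)) (∪-identityʳ A) ⟩
  A ∩ (B ∪ ⁅ j ⁆)        ≡⟨ ∩-comm A _ ⟩
  (B ∪ ⁅ j ⁆) ∩ A        ≡⟨ x∉q⇒[p∪⁅x⁆]∩q≡p∩q j∉A ⟩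
  B ∩ A                  ≡⟨ ∩-comm B A ⟩
  A ∩ B                  ∎)
  where open ≡-Reasoning

#skew≤1⇒#skew-∖⟦⟧≡0 : #skew X ≤ 1 → e ∈E X → star e ∈E X → #skew (X ∖E ⟦ e ⟧) ≡ 0
#skew≤1⇒#skew-∖⟦⟧≡0 {X = A , B} {e = inj₁ j} #skew≤1 j∈A j∈B = Empty⇒∣p∣≡0 λ (i , i∈) →
  let i∈A─j , i∈B─∅ = x∈p∩q⁻ (A ─ ⁅ j ⁆) (B ─ ∅) i∈
      i∈A∩B = x∈p∩q⁺ (p─q⊆p _ _ i∈A─j , p─q⊆p _ _ i∈B─∅)
  in x∈p─q⇒x∉q i∈A─j (Equivalence.from x∈⁅y⁆⇔x≡y (∣p∣≤1⇒x≡y #skew≤1 i∈A∩B (x∈p∩q⁺ (j∈A , j∈B))))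
#skew≤1⇒#skew-∖⟦⟧≡0 {X = A , B} {e = inj₂ j} #skew≤1 j∈B j∈A = Empty⇒∣p∣≡0 λ (i , i∈) →
  let i∈A─∅ , i∈B─j = x∈p∩q⁻ (A ─ ∅) (B ─ ⁅ j ⁆) i∈
      i∈A∩B = x∈p∩q⁺ (p─q⊆p _ _ i∈A─∅ , p─q⊆p _ _ i∈B─j)
  in x∈p─q⇒x∉q i∈B─j (Equivalence.from x∈⁅y⁆⇔x≡y (∣p∣≤1⇒x≡y #skew≤1 i∈A∩B (x∈p∩q⁺ (j∈A , j∈B))))

∣X∪⟦e⟧∣≡1+∣X∣ : e ∉E X → ∣ X ∪E ⟦ e ⟧ ∣E ≡ suc ∣ X ∣E
∣X∪⟦e⟧∣≡1+∣X∣ {e = inj₁ _} {X = A , B} i∉A =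
  cong₂ _+_ (x∉p⇒∣p∪⁅x⁆∣≡1+∣p∣ i∉A) (cong ∣_∣ (∪-identityʳ B))
∣X∪⟦e⟧∣≡1+∣X∣ {e = inj₂ _} {X = A , B} i∉B =
  trans (cong₂ _+_ (cong ∣_∣ (∪-identityʳ A)) (x∉p⇒∣p∪⁅x⁆∣≡1+∣p∣ i∉B)) (+-suc ∣ A ∣ ∣ B ∣)

∣X∣≡1⇒∃! : ∣ X ∣E ≡ 1 → ∃[ e ] (e ∈E X × ∀ {d} → d ∈E X → d ≡ e)
∣X∣≡1⇒∃! {X = A , B} ∣X∣≡1 with ∣ A ∣ in ∣A∣≡
... | 0 = let i , i∈B , unique = ∣p∣≡1⇒∃! ∣X∣≡1 in inj₂ i , i∈B , λ
  { {inj₁ _} j∈A → contradiction j∈A (∣p∣≡0⇒x∉p ∣A∣≡)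
  ; {inj₂ _} j∈B → cong inj₂ (unique j∈B)
  }
... | 1 = let i , i∈A , unique = ∣p∣≡1⇒∃! ∣A∣≡ in inj₁ i , i∈A , λ
  { {inj₁ _} j∈A → cong inj₁ (unique j∈A)
  ; {inj₂ _} j∈B → contradiction j∈B (∣p∣≡0⇒x∉p (suc-injective ∣X∣≡1))
  }

-- #skew (X ᶜ) counts the indices i such that neither i nor i* lies in X.
∣X∣+#skewXᶜ≡n+#skewX : ∀ (X : ESub n) → ∣ X ∣E + #skew (X ᶜ) ≡ n + #skew X
∣X∣+#skewXᶜ≡n+#skewX (A , B) = ∣p∣+∣q∣+∣∁p∩∁q∣≡n+∣p∩q∣ A B

∣X∣≡n⇒#skewXᶜ≡#skewX : ∀ (X : ESub n) → ∣ X ∣E ≡ n → #skew (X ᶜ) ≡ #skew X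
∣X∣≡n⇒#skewXᶜ≡#skewX {n} X ∣X∣≡n =
  +-cancelˡ-≡ n _ _ (trans (cong (_+ #skew (X ᶜ)) (sym ∣X∣≡n)) (∣X∣+#skewXᶜ≡n+#skewX X))

∣X∣≡1+n⇒#skewX≡1+#skewXᶜ : ∀ (X : ESub n) → ∣ X ∣E ≡ suc n → #skew X ≡ suc (#skew (X ᶜ))
∣X∣≡1+n⇒#skewX≡1+#skewXᶜ {n} X ∣X∣≡1+n = +-cancelˡ-≡ n _ _ (begin
  n + #skew X             ≡⟨ ∣X∣+#skewXᶜ≡n+#skewX X ⟨
  ∣ X ∣E + #skew (X ᶜ)    ≡⟨ cong (_+ #skew (X ᶜ)) ∣X∣≡1+n ⟩
  suc n + #skew (X ᶜ)     ≡⟨ +-suc n _ ⟨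
  n + suc (#skew (X ᶜ))   ∎)
  where open ≡-Reasoning

ᶜ*∖⟦e⟧-skewFree : ∀ (X : ESub n) → ∣ X ∣E ≡ n → star e ∉E X → #skew (X ∪E ⟦ star e ⟧) ≡ 1 →
                  #skew ((X ᶜ *) ∖E ⟦ e ⟧) ≡ 0
ᶜ*∖⟦e⟧-skewFree {e = e} X ∣X∣≡n e*∉X #skew≡1 = begin
  #skew ((X ᶜ *) ∖E ⟦ e ⟧)         ≡⟨ cong #skew (ᶜ*∖⟦e⟧≡[X∪⟦e*⟧]ᶜ* {X = X} {e = e}) ⟩
  #skew ((X ∪E ⟦ star e ⟧) ᶜ *)    ≡⟨ #skew-* ((X ∪E ⟦ star e ⟧) ᶜ) ⟩
  #skew ((X ∪E ⟦ star e ⟧) ᶜ)      ≡⟨ suc-injective (trans (sym #skew≡1) #skew≡1+#skewᶜ) ⟨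
  0                                ∎
  where
  open ≡-Reasoning
  #skew≡1+#skewᶜ : #skew (X ∪E ⟦ star e ⟧) ≡ suc (#skew ((X ∪E ⟦ star e ⟧) ᶜ))
  #skew≡1+#skewᶜ = ∣X∣≡1+n⇒#skewX≡1+#skewXᶜ (X ∪E ⟦ star e ⟧)
                     (trans (∣X∪⟦e⟧∣≡1+∣X∣ e*∉X) (cong suc ∣X∣≡n))

Transversal-[p,∁p] : (p : Subset n) → Transversal (p , ∁ p)
Transversal-[p,∁p] {n} p = trans (cong (∣ p ∣ +_) (∣∁p∣≡n∸∣p∣ p)) (m+[n∸m]≡n (∣p∣≤n p))
                         , trans (cong ∣_∣ (∩-inverseʳ p)) (∣⊥∣≡0 n)

Transversal⇒#skewᶜ≡0 : ∀ (X : ESub n) → Transversal X → #skew (X ᶜ) ≡ 0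
Transversal⇒#skewᶜ≡0 X (∣X∣≡n , #skew≡0) = trans (∣X∣≡n⇒#skewXᶜ≡#skewX X ∣X∣≡n) #skew≡0

Transversal⇒ᶜ*≡ : ∀ (X : ESub n) → Transversal X → X ᶜ * ≡ X
Transversal⇒ᶜ*≡ X t = ⊆E-antisym ⊆X (λ e e∈X → ∈ᶜ*⁺ (#skew≡0⇒star∉ (proj₂ t) e∈X))
  where
  ⊆X : X ᶜ * ⊆E X
  ⊆X e e∈ = decidable-stable (e ∈E? X) λ e∉X →
    #skew≡0⇒star∉ {X = X ᶜ} (Transversal⇒#skewᶜ≡0 X t) (ᶜ⁺ e∉X) (ᶜ⁺ (∈ᶜ*⁻ e∈))

Transversal⇒#skew∪⟦⟧≡1 : ∀ (X : ESub n) → Transversal X → e ∉E X → #skew (X ∪E ⟦ e ⟧) ≡ 1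
Transversal⇒#skew∪⟦⟧≡1 {e = e} X t@(∣X∣≡n , _) e∉X = begin
  #skew (X ∪E ⟦ e ⟧)             ≡⟨ ∣X∣≡1+n⇒#skewX≡1+#skewXᶜ (X ∪E ⟦ e ⟧) ∣X∪e∣≡1+n ⟩
  suc (#skew ((X ∪E ⟦ e ⟧) ᶜ))   ≡⟨ cong suc (n≤0⇒n≡0 #skew[X∪e]ᶜ≤0) ⟩
  1                              ∎
  where
  open ≡-Reasoning
  ∣X∪e∣≡1+n : ∣ X ∪E ⟦ e ⟧ ∣E ≡ suc _
  ∣X∪e∣≡1+n = trans (∣X∪⟦e⟧∣≡1+∣X∣ e∉X) (cong suc ∣X∣≡n)
  #skew[X∪e]ᶜ≤0 : #skew ((X ∪E ⟦ e ⟧) ᶜ) ≤ 0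
  #skew[X∪e]ᶜ≤0 = ≤-trans (#skew-mono (ᶜ-antitone {Y = X ∪E ⟦ e ⟧} λ _ → ∪E⁺ˡ))
                          (≤-reflexive (Transversal⇒#skewᶜ≡0 X t))

-- Bases and circuits

module _ {n : ℕ} {𝓑 : ESub n → Set} (M : IsAntisymmetricMatroid n 𝓑) where
  open IsAntisymmetricMatroid M

  basis⇒∣X∣≡n : 𝓑 X → ∣ X ∣E ≡ n
  basis⇒∣X∣≡n {X = X} bX = [ proj₁ , proj₁ ]′ (bases-shape X bX)

  basis⇒#skew≤1 : 𝓑 X → #skew X ≤ 1
  basis⇒#skew≤1 {X = X} bX with bases-shape X bX
  ... | inj₁ (_ , #skew≡0) = subst (_≤ 1) (sym #skew≡0) z≤n
  ... | inj₂ (_ , #skew≡1) = ≤-reflexive #skew≡1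

  skewFree-basis⇒Transversal : 𝓑 X → #skew X ≡ 0 → Transversal X
  skewFree-basis⇒Transversal {X = X} bX #skew≡0 with bases-shape X bX
  ... | inj₁ t             = t
  ... | inj₂ (_ , #skew≡1) = contradiction (trans (sym #skew≡0) #skew≡1) λ ()

  -- An almost-transversal X with skew pair p and no element of index q is (T ∪ p) ∖ q for
  -- the transversal T = (A , ∁ A), and (B2) turns it into (T ∪ q) ∖ p = X ᶜ *.
  basis-ᶜ* : 𝓑 X → 𝓑 (X ᶜ *)
  basis-ᶜ* {X = X} bX with bases-shape X bX
  ... | inj₁ t                 = subst 𝓑 (sym (Transversal⇒ᶜ*≡ X t)) bX
  ... | inj₂ (∣X∣≡n , #skew≡1) =
    swap-pair (∣p∣≡1⇒∃! #skew≡1) (∣p∣≡1⇒∃! (trans (∣X∣≡n⇒#skewXᶜ≡#skewX X ∣X∣≡n) #skew≡1))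
    where
    A = proj₁ X
    B = proj₂ X
    swap-pair : ∃[ p ] (p ∈ A ∩ B × ∀ {i} → i ∈ A ∩ B → i ≡ p) →
                ∃[ q ] (q ∈ ∁ A ∩ ∁ B × ∀ {i} → i ∈ ∁ A ∩ ∁ B → i ≡ q) → 𝓑 (X ᶜ *)
    swap-pair (p , p∈A∩B , pair-unique) (q , q∈∁A∩∁B , hole-unique) =
      subst 𝓑 T∪q∖p≡Xᶜ* (Equivalence.to (B2 T (Transversal-[p,∁p] A) p q p≢q) (subst 𝓑 (sym T∪p∖q≡X) bX))
      where
      T : ESub n
      T = A , ∁ A
      p∈A : p ∈ A
      p∈A = proj₁ (x∈p∩q⁻ A B p∈A∩B)
      q∉A : q ∉ A
      q∉A = x∈∁p⇒x∉p (proj₁ (x∈p∩q⁻ (∁ A) (∁ B) q∈∁A∩∁B))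
      p≢q : p ≢ q
      p≢q refl = q∉A p∈A
      T∪p∖q≡X : (T ∪E skew p) ∖E skew q ≡ X
      T∪p∖q≡X = cong₂ _,_ (x∈p∧y∉p⇒p∪⁅x⁆─⁅y⁆≡p p∈A q∉A)
                          (sym (B≡∁A∪⁅p⁆─⁅q⁆ p∈A∩B pair-unique q∈∁A∩∁B hole-unique))
      T∪q∖p≡Xᶜ* : (T ∪E skew q) ∖E skew p ≡ X ᶜ *
      T∪q∖p≡Xᶜ* = cong₂ _,_ (sym (∁B≡A∪⁅q⁆─⁅p⁆ p∈A∩B pair-unique q∈∁A∩∁B hole-unique))
                            (x∈p∧y∉p⇒p∪⁅x⁆─⁅y⁆≡p (x∉p⇒x∈∁p q∉A) (x∈p⇒x∉∁p p∈A))

  -- Exchange e against the basis X ᶜ *: every f ∈ X ᶜ * has f* ∉ X, so adding f creates no skew pair.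
  skew-pair-element-exchange : 𝓑 X → AlmostTransversal X → e ∈E X → star e ∈E X →
                               ∃[ f ] (𝓑 ((X ∖E ⟦ e ⟧) ∪E ⟦ f ⟧) × #skew ((X ∖E ⟦ e ⟧) ∪E ⟦ f ⟧) ≡ 0)
  skew-pair-element-exchange {X = X} {e = e} bX (∣X∣≡n , #skew≡1) e∈X e*∈X =
    let f , f∈Xᶜ* , _ , bX′ , _ = Exch X (X ᶜ *) bX (basis-ᶜ* bX) e e∈X e∉Xᶜ* #skewX∖e≡0 #skewXᶜ*∪e≡1
    in f , bX′ , trans (star∉⇒#skew-∪⟦⟧ (X ∖E ⟦ e ⟧) λ f*∈ → ∈ᶜ*⁻ {e = f} f∈Xᶜ* (proj₁ (∖E⁻ f*∈))) #skewX∖e≡0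
    where
    e∉Xᶜ* : e ∉E X ᶜ *
    e∉Xᶜ* e∈ = ∈ᶜ*⁻ {e = e} e∈ e*∈X
    e*∉Xᶜ* : star e ∉E X ᶜ *
    e*∉Xᶜ* e*∈ = ∈ᶜ*⁻ {e = star e} e*∈ (subst (_∈E X) (sym star-involutive) e∈X)
    #skewX∖e≡0 : #skew (X ∖E ⟦ e ⟧) ≡ 0
    #skewX∖e≡0 = #skew≤1⇒#skew-∖⟦⟧≡0 (basis⇒#skew≤1 bX) e∈X e*∈X
    #skewXᶜ*∪e≡1 : #skew ((X ᶜ *) ∪E ⟦ e ⟧) ≡ 1
    #skewXᶜ*∪e≡1 = begin
      #skew ((X ᶜ *) ∪E ⟦ e ⟧)  ≡⟨ star∉⇒#skew-∪⟦⟧ (X ᶜ *) e*∉Xᶜ* ⟩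
      #skew (X ᶜ *)             ≡⟨ #skew-* (X ᶜ) ⟩
      #skew (X ᶜ)               ≡⟨ ∣X∣≡n⇒#skewXᶜ≡#skewX X ∣X∣≡n ⟩
      #skew X                   ≡⟨ #skew≡1 ⟩
      1                         ∎
      where open ≡-Reasoning

  transversal-basis-⊇ : Independent 𝓑 Y → #skew Y ≡ 0 → ∃[ T ] (𝓑 T × Transversal T × Y ⊆E T)
  transversal-basis-⊇ (X , bX , Y⊆X) #skewY≡0 with bases-shape X bX
  ... | inj₁ t                      = X , bX , t , Y⊆X
  ... | inj₂ almost@(_ , #skewX≡1) =
    let p , p∈pairs , _         = ∣p∣≡1⇒∃! #skewX≡1
        p∈X , p*∈X              = pairs⁻ X p∈pairs
        b , b∈X , b*∈X , b∉Y    = #skew≡0⇒pair-element∉ {e = inj₁ p} #skewY≡0 p∈X p*∈X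
        f , bX′ , #skewX′≡0     = skew-pair-element-exchange bX almost b∈X b*∈X
    in (X ∖E ⟦ b ⟧) ∪E ⟦ f ⟧ , bX′ , skewFree-basis⇒Transversal bX′ #skewX′≡0 ,
       λ d d∈Y → ∪E⁺ˡ (⊆∖⟦⟧ Y⊆X b∉Y d d∈Y)

  FundamentalBasis : ESub n → El n → ESub n → Set
  FundamentalBasis C e B = 𝓑 B × C ⊆E B ∪E ⟦ e ⟧ × #skew (B ∪E ⟦ e ⟧) ≡ 1

  module _ {C : ESub n} (circuit : IsCircuit 𝓑 C) where

    circuit⊈basis : 𝓑 X → C ⊆E X → ⊥
    circuit⊈basis {X = X} bX C⊆X = proj₁ (proj₂ circuit) (X , bX , C⊆X)

    circuit⊆basis∪⟦e⟧⇒e∉basis : 𝓑 X → C ⊆E X ∪E ⟦ e ⟧ → e ∉E X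
    circuit⊆basis∪⟦e⟧⇒e∉basis bX C⊆X∪e e∈X = circuit⊈basis bX (⊆∪⟦⟧⇒⊆ C⊆X∪e e∈X)

    circuit∖⟦e⟧-independent : e ∈E C → Independent 𝓑 (C ∖E ⟦ e ⟧)
    circuit∖⟦e⟧-independent {e = e} e∈C =
      proj₂ (proj₂ circuit) (C ∖E ⟦ e ⟧) C∖e⊆C C∖e≢C (≤-trans (#skew-mono C∖e⊆C) (proj₁ circuit))
      where
      C∖e⊆C : C ∖E ⟦ e ⟧ ⊆E C
      C∖e⊆C d = proj₁ ∘ ∖E⁻ {e = d}
      C∖e≢C : C ∖E ⟦ e ⟧ ≢ C
      C∖e≢C C∖e≡C = proj₂ (∖E⁻ {e = e} (subst (e ∈E_) (sym C∖e≡C) e∈C)) e∈⟦e⟧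

    circuit⊆transversal∪⟦e⟧ : e ∈E C → #skew (C ∖E ⟦ e ⟧) ≡ 0 →
                              ∃[ T ] (𝓑 T × Transversal T × C ⊆E T ∪E ⟦ e ⟧)
    circuit⊆transversal∪⟦e⟧ {e = e} e∈C #skew≡0 =
      let T , bT , tT , C∖e⊆T = transversal-basis-⊇ (circuit∖⟦e⟧-independent e∈C) #skew≡0
      in T , bT , tT , ∖⟦⟧⊆⇒⊆∪⟦⟧ {e = e} C∖e⊆T

    -- Exchanging a from B into T must receive e: any other f ∉ B lies outside C, and then
    -- C ⊆ (T ∪ {a}) ∖ {f} would be contained in a basis.
    fundamental-basis-by-exchange : ∀ {B T : ESub n} {a : El n} →
      𝓑 B → C ⊆E B ∪E ⟦ e ⟧ → a ∈E B → star a ∈E B → 𝓑 T → Transversal T → C ⊆E T ∪E ⟦ a ⟧ →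
      ∃[ B′ ] FundamentalBasis C e B′
    fundamental-basis-by-exchange {e = e} {B} {T} {a} bB C⊆B∪e a∈B a*∈B bT tT C⊆T∪a =
      finish (Exch B T bB bT a a∈B a∉T (#skew≤1⇒#skew-∖⟦⟧≡0 (basis⇒#skew≤1 bB) a∈B a*∈B) #skewT∪a≡1)
      where
      a∉T : a ∉E T
      a∉T = circuit⊆basis∪⟦e⟧⇒e∉basis {e = a} bT C⊆T∪a
      #skewT∪a≡1 : #skew (T ∪E ⟦ a ⟧) ≡ 1
      #skewT∪a≡1 = Transversal⇒#skew∪⟦⟧≡1 T tT a∉T
      finish : ∃[ f ] (f ∈E T × f ∉E B × 𝓑 ((B ∖E ⟦ a ⟧) ∪E ⟦ f ⟧) × 𝓑 ((T ∪E ⟦ a ⟧) ∖E ⟦ f ⟧)) →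
               ∃[ B′ ] FundamentalBasis C e B′
      finish (f , f∈T , f∉B , _ , bT∪a∖f) with f ≟E e
      ... | yes refl = (T ∪E ⟦ a ⟧) ∖E ⟦ f ⟧ , bT∪a∖f ,
                       subst (C ⊆E_) (sym re-add) C⊆T∪a , subst (λ Y → #skew Y ≡ 1) (sym re-add) #skewT∪a≡1
        where
        re-add : ((T ∪E ⟦ a ⟧) ∖E ⟦ f ⟧) ∪E ⟦ f ⟧ ≡ T ∪E ⟦ a ⟧
        re-add = ∖⟦e⟧∪⟦e⟧≡ (∪E⁺ˡ f∈T)
      ... | no  f≢e  = ⊥-elim (circuit⊈basis bT∪a∖f (⊆∖⟦⟧ C⊆T∪a f∉C))
        where
        f∉C : f ∉E C
        f∉C f∈C = [ f∉B , f≢e ∘ d∈⟦e⟧⇒d≡e ]′ (∪E⁻ (C⊆B∪e f f∈C))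

    fundamental-basis-of-pair : e ∈E C → d ∈E C ∖E ⟦ e ⟧ → star d ∈E C ∖E ⟦ e ⟧ →
                                ∃[ B ] FundamentalBasis C e B
    fundamental-basis-of-pair {e = e} {d = a} e∈C a∈C∖e a*∈C∖e =
      let T , bT , tT , C⊆T∪a = circuit⊆transversal∪⟦e⟧ {e = a} a∈C
                                  (#skew≤1⇒#skew-∖⟦⟧≡0 (proj₁ circuit) a∈C a*∈C)
          B , bB , C∖e⊆B      = circuit∖⟦e⟧-independent e∈C
      in fundamental-basis-by-exchange {e = e} bB (∖⟦⟧⊆⇒⊆∪⟦⟧ {e = e} C∖e⊆B)
           (C∖e⊆B a a∈C∖e) (C∖e⊆B (star a) a*∈C∖e) bT tT C⊆T∪a
      where
      a∈C : a ∈E C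
      a∈C = proj₁ (∖E⁻ a∈C∖e)
      a*∈C : star a ∈E C
      a*∈C = proj₁ (∖E⁻ a*∈C∖e)

    fundamental-basis : e ∈E C → ∃[ B ] FundamentalBasis C e B
    fundamental-basis {e = e} e∈C with nonempty? (pairs (C ∖E ⟦ e ⟧))
    ... | no no-pair =
      let T , bT , tT , C⊆T∪e = circuit⊆transversal∪⟦e⟧ e∈C (Empty⇒∣p∣≡0 no-pair)
      in T , bT , C⊆T∪e , Transversal⇒#skew∪⟦⟧≡1 T tT (circuit⊆basis∪⟦e⟧⇒e∉basis {e = e} bT C⊆T∪e)
    ... | yes (i , i∈pairs) =
      uncurry (fundamental-basis-of-pair {d = inj₁ i} e∈C) (pairs⁻ (C ∖E ⟦ e ⟧) i∈pairs)

  circuit-skew-meet-not-unique : ∀ {C₁ C₂} → IsCircuit 𝓑 C₁ → IsCircuit 𝓑 C₂ →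
                                 e ∈E C₁ → star e ∈E C₂ → (∀ {d} → d ∈E C₁ → star d ∈E C₂ → d ≡ e) → ⊥
  circuit-skew-meet-not-unique {e = e} {C₁} {C₂} c₁ c₂ e∈C₁ e*∈C₂ unique
    with fundamental-basis c₁ e∈C₁ | fundamental-basis c₂ e*∈C₂
  ... | B₁ , bB₁ , C₁⊆B₁∪e , #skewB₁∪e≡1 | B₂ , bB₂ , C₂⊆B₂∪e* , #skewB₂∪e*≡1 =
    finish (Exch (B₂ ᶜ *) B₁ (basis-ᶜ* bB₂) bB₁ e (∈ᶜ*⁺ e*∉B₂) e∉B₁
                 (ᶜ*∖⟦e⟧-skewFree B₂ (basis⇒∣X∣≡n bB₂) e*∉B₂ #skewB₂∪e*≡1) #skewB₁∪e≡1)
    where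
    e∉B₁ : e ∉E B₁
    e∉B₁ = circuit⊆basis∪⟦e⟧⇒e∉basis c₁ {e = e} bB₁ C₁⊆B₁∪e
    e*∉B₂ : star e ∉E B₂
    e*∉B₂ = circuit⊆basis∪⟦e⟧⇒e∉basis c₂ {e = star e} bB₂ C₂⊆B₂∪e*
    finish : ∃[ f ] (f ∈E B₁ × f ∉E B₂ ᶜ * × 𝓑 (((B₂ ᶜ *) ∖E ⟦ e ⟧) ∪E ⟦ f ⟧) × 𝓑 ((B₁ ∪E ⟦ e ⟧) ∖E ⟦ f ⟧)) →
             ⊥
    finish (f , f∈B₁ , _ , bB₃ , bB₁∪e∖f) = circuit⊈basis c₂ (basis-ᶜ* bB₃) C₂⊆B₃ᶜ*
      where
      f∈C₁ : f ∈E C₁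
      f∈C₁ = decidable-stable (f ∈E? C₁) λ f∉C₁ → circuit⊈basis c₁ bB₁∪e∖f (⊆∖⟦⟧ C₁⊆B₁∪e f∉C₁)
      f≢e : f ≢ e
      f≢e refl = e∉B₁ f∈B₁
      C₂⊆B₃ᶜ* : C₂ ⊆E (((B₂ ᶜ *) ∖E ⟦ e ⟧) ∪E ⟦ f ⟧) ᶜ *
      C₂⊆B₃ᶜ* d d∈C₂ = ∈ᶜ*⁺ {e = d} ([ d*∉B₂ᶜ*∖e , f≢e ∘ unique f∈C₁ ∘ f*∈C₂ ∘ d∈⟦e⟧⇒d≡e ]′ ∘ ∪E⁻ {e = star d})
        where
        f*∈C₂ : star d ≡ f → star f ∈E C₂
        f*∈C₂ refl = subst (_∈E C₂) (sym star-involutive) d∈C₂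
        d*∉B₂ᶜ*∖e : star d ∉E (B₂ ᶜ *) ∖E ⟦ e ⟧
        d*∉B₂ᶜ*∖e d*∈ with ∖E⁻ {e = star d} d*∈ | ∪E⁻ {e = d} (C₂⊆B₂∪e* d d∈C₂)
        ... | d*∈B₂ᶜ* , _      | inj₁ d∈B₂   =
          ∈ᶜ*⁻ {e = star d} d*∈B₂ᶜ* (subst (_∈E B₂) (sym star-involutive) d∈B₂)
        ... | _       , d*∉⟦e⟧ | inj₂ d∈⟦e*⟧ =
          d*∉⟦e⟧ (d≡e⇒d∈⟦e⟧ (trans (cong star (d∈⟦e⟧⇒d≡e d∈⟦e*⟧)) star-involutive))

lemma3p8 : ∀ (n : ℕ) (𝓑 : ESub n → Set) → IsAntisymmetricMatroid n 𝓑 →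
    ∀ (C₁ C₂ : ESub n) → IsCircuit 𝓑 C₁ → IsCircuit 𝓑 C₂ →
    ∣ C₁ ∩E (C₂ *) ∣E ≢ 1
lemma3p8 n 𝓑 M C₁ C₂ c₁ c₂ ∣C₁∩C₂*∣≡1 =
  let e , e∈C₁∩C₂* , unique = ∣X∣≡1⇒∃! ∣C₁∩C₂*∣≡1
      e∈C₁ , e∈C₂*           = ∩E⁻ {X = C₁} e∈C₁∩C₂*
  in circuit-skew-meet-not-unique M c₁ c₂ e∈C₁ (*⁻ {e = e} e∈C₂*)
       λ d∈C₁ d*∈C₂ → unique (∩E⁺ (d∈C₁ , *⁺ d*∈C₂))
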